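{- Let $(i,j),(m,n)\in\mathbb{Z}\oplus\mathbb{Z}$ with $(0,0)<(i,j)\le(m,n)$, and let $g,h\in\mathrm{GL}_2(F)$. Then the intersection $gK_{i,j}\cap hK_{m,n}$ is either empty or equal to one of $gK_{i,j}$, $hK_{m,n}$.
   Context: $F$ is a two-dimensional nonarchimedean local field: a complete discrete valuation field whose residue field is a nonarchimedean local field. Fix a rank two valuation $v:F^\times\to\mathbb{Z}\oplus\mathbb{Z}$, where $\mathbb{Z}\oplus\mathbb{Z}$ is ordered lexicographically from the right: $(a,b)<(c,d)$ iff $b<d$, or $b=d$ and $a<c$. Fix local parameters $t_1,t_2$ with $v(t_1)=(1,0)$, $v(t_2)=(0,1)$, and let $O_F=\{x\in F^\times: v(x)\ge(0,0)\}\cup\{0\}$. For $(i,j)>(0,0)$, $K_{i,j}=I_2+t_1^it_2^jM_2(O_F)$; these are subgroups of $\mathrm{GL}_2(F)$ with $K_{m,n}\subset K_{i,j}$ whenever $(i,j)\le(m,n)$. -}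

module Defs where

open import Level using (Level; _⊔_) renaming (suc to lsuc)
open import Algebra.Bundles using (CommutativeRing)
open import Data.Integer using (ℤ; +_; _<_; _≤_; 0ℤ; 1ℤ)
open import Data.Nat using (ℕ) renaming (_≤_ to _≤ℕ_)
open import Data.Product using (Σ; _×_; ∃; ∃-syntax; _,_)
open import Data.Sum using (_⊎_)
open import Data.List using (List)
open import Data.List.Membership.Propositional using (_∈_)
open import Relation.Binary.PropositionalEquality using (_≡_)
open import Relation.Nullary using (¬_)
open import Function.Bundles using (_⇔_)

-- The value group ℤ ⊕ ℤ (with ∞ for the valuation of 0), ordered
-- lexicographically from the right:
-- (a,b) < (c,d) iff b < d, or b = d and a < c.

data ValInf : Set where
  fin : ℤ → ℤ → ValInf
  ∞   : ValInf

infix 4 _≤v_ _<v_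

_≤v_ : ValInf → ValInf → Set
_       ≤v ∞       = Data.Unit.⊤ where import Data.Unit
∞       ≤v fin _ _ = Data.Empty.⊥ where import Data.Empty
fin a b ≤v fin c d = (b < d) ⊎ ((b ≡ d) × (a ≤ c))

_<v_ : ValInf → ValInf → Set
fin a b <v fin c d = (b < d) ⊎ ((b ≡ d) × (a < c))
fin _ _ <v ∞       = Data.Unit.⊤ where import Data.Unit
∞       <v _       = Data.Empty.⊥ where import Data.Empty

-- the discrete (rank one) valuation v₂ = second coordinate of v, compared with N
-- "N ≤ v₂(x)" in terms of the value of v(x)
_≤₂_ : ℤ → ValInf → Set
N ≤₂ fin _ b = N ≤ b
N ≤₂ ∞       = Data.Unit.⊤ where import Data.Unit

vAdd : ValInf → ValInf → ValInf
vAdd (fin a b) (fin c d) = fin (a Data.Integer.+ c) (b Data.Integer.+ d)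
  where import Data.Integer
vAdd (fin _ _) ∞ = ∞
vAdd ∞ _ = ∞

record TwoDimLocalField c ℓ : Set (lsuc (c ⊔ ℓ)) where
  field
    commRing : CommutativeRing c ℓ
  open CommutativeRing commRing public hiding (ring)

  field
    1≉0     : ¬ (1# ≈ 0#)
    inverse : ∀ x → ¬ (x ≈ 0#) → ∃[ y ] (x * y ≈ 1#)

    v       : Carrier → ValInf
    v-cong  : ∀ {x y} → x ≈ y → v x ≡ v y
    v-∞     : ∀ x → (v x ≡ ∞) ⇔ (x ≈ 0#)
    v-mul   : ∀ x y → v (x * y) ≡ vAdd (v x) (v y)
    v-add   : ∀ x y w → w ≤v v x → w ≤v v y → w ≤v v (x + y)

    t₁ t₂   : Carrier
    v-t₁    : v t₁ ≡ fin 1ℤ 0ℤ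
    v-t₂    : v t₂ ≡ fin 0ℤ 1ℤ

    -- F is complete for the discrete valuation v₂ (second coordinate of v)
    complete :
      (s : ℕ → Carrier) →
      (∀ (N : ℤ) → ∃[ M ] (∀ p q → M ≤ℕ p → M ≤ℕ q → N ≤₂ v (s p - s q))) →
      ∃[ L ] (∀ (N : ℤ) → ∃[ M ] (∀ p → M ≤ℕ p → N ≤₂ v (s p - L)))

    -- the residue field of v₂, i.e. {v₂ ≥ 0}/{v₂ > 0}, is a nonarchimedean
    -- local field w.r.t. the valuation induced by the first coordinate of v:
    -- (i) it is complete (stated on lifts to {v₂ ≥ 0}),
    residue-complete :
      (s : ℕ → Carrier) → (∀ n → 0ℤ ≤₂ v (s n)) →
      (∀ (N : ℤ) → ∃[ M ] (∀ p q → M ≤ℕ p → M ≤ℕ q → fin N 0ℤ ≤v v (s p - s q))) →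
      ∃[ L ] ((0ℤ ≤₂ v L) ×
              (∀ (N : ℤ) → ∃[ M ] (∀ p → M ≤ℕ p → fin N 0ℤ ≤v v (s p - L))))
    -- (ii) its residue field O_F/{v > (0,0)} is finite
    residue-finite :
      Σ (List Carrier) λ reps → (∀ x → fin 0ℤ 0ℤ ≤v v x →
                   ∃[ y ] ((y ∈ reps) × (fin 0ℤ 0ℤ <v v (x - y))))
    -- (the induced valuation on the residue field is nontrivial and discrete:
    --  this follows from v being ℤ⊕ℤ-valued and v t₁ = (1,0))

  record M2 : Set c where
    constructor mat
    pattern
    field
      a₁₁ a₁₂ a₂₁ a₂₂ : Carrier

  infix 4 _≈M_
  _≈M_ : M2 → M2 → Set ℓ
  mat a b c' d ≈M mat a' b' c'' d' = (a ≈ a') × (b ≈ b') × (c' ≈ c'') × (d ≈ d')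

  infixl 7 _·_
  _·_ : M2 → M2 → M2
  mat a b c' d · mat e f g h =
    mat (a * e + b * g) (a * f + b * h) (c' * e + d * g) (c' * f + d * h)

  det : M2 → Carrier
  det (mat a b c' d) = a * d - b * c'

  GL₂ : M2 → Set ℓ
  GL₂ g = ¬ (det g ≈ 0#)

  -- K_{i,j} = I₂ + t₁^i t₂^j M₂(O_F): every entry of k - I₂ lies in the
  -- fractional ideal t₁^i t₂^j O_F = {x : v x ≥ (i,j)}
  K : ℤ → ℤ → M2 → Set
  K i j (mat a b c' d) =
    (fin i j ≤v v (a - 1#)) × (fin i j ≤v v b) × (fin i j ≤v v c') × (fin i j ≤v v (d - 1#))

  InCoset : M2 → ℤ → ℤ → M2 → Set (c ⊔ ℓ)
  InCoset g i j x = ∃[ k ] (K i j k × (x ≈M g · k))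

module Submission where

-- Write P_w = {x ∈ F : w ≤ v x} for the fractional ideal of level w.  For
-- w = (i,j) > (0,0) the ideal P_w is closed under products, so the set K_{i,j}
-- of matrices congruent to I₂ modulo P_w is closed under multiplication; its
-- determinants are congruent to 1, hence units of O_F, so the adjugate formula
-- shows that it is also closed under inversion.  Thus K_{i,j} is a group, and
-- K_{m,n} ⊆ K_{i,j} for (i,j) ≤ (m,n).  The theorem is then the usual coset
-- argument: if g⁻¹h ∈ K_{i,j} then hK_{m,n} ⊆ hK_{i,j} = gK_{i,j}, and if
-- gk = hk' for k ∈ K_{i,j}, k' ∈ K_{m,n}, then g⁻¹h = k k'⁻¹ ∈ K_{i,j}.
-- Membership in K_{i,j} is decidable, which yields the trichotomy.

open import Defs
open import Algebra.Bundles using (CommutativeRing)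
open import Level using (Level; _⊔_)
open import Data.Integer using (ℤ; 0ℤ)
open import Data.Product using (Σ; _×_; proj₁; proj₂)
open import Data.Sum using (_⊎_)
open import Relation.Nullary using (¬_)
open import Function.Bundles using (_⇔_)

module IntegerCoefficientSolver {c ℓ : Level} (R : CommutativeRing c ℓ) where
  open import Algebra.Solver.Ring.AlmostCommutativeRing
    using (AlmostCommutativeRing; fromCommutativeRing; _-Raw-AlmostCommutative⟶_)
  open import Data.Nat as ℕ using (zero; suc)
  import Data.Nat.Properties as ℕP
  open import Data.Integer as ℤ using (+_; -[1+_]; _⊖_)
  import Data.Integer.Properties as ℤP
  open import Data.Sign as Sign using (Sign)
  open import Data.Maybe using (Maybe; just; nothing)
  open import Relation.Nullary using (yes; no)
  import Relation.Binary.PropositionalEquality as ≡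

  open CommutativeRing R hiding (zero)
  open import Algebra.Properties.Semiring.Mult.TCOptimised semiring renaming (_×_ to _·×_)
  open import Algebra.Properties.Ring ring using (-1*x≈-x; -‿involutive; -0#≈0#)
  open import Algebra.Properties.AbelianGroup +-abelianGroup using (⁻¹-∙-comm; xyx⁻¹≈y)
  open import Relation.Binary.Reasoning.Setoid setoid

  ⟦_⟧ℤ : ℤ → Carrier
  ⟦ + n ⟧ℤ = n ·× 1#
  ⟦ -[1+ n ] ⟧ℤ = - (suc n ·× 1#)

  suc-minus-suc : ∀ x y → (1# + x) - (1# + y) ≈ x - y
  suc-minus-suc x y = begin
    (1# + x) - (1# + y)     ≈⟨ +-congˡ (sym (⁻¹-∙-comm 1# y)) ⟩
    (1# + x) + (- 1# - y)   ≈⟨ +-congˡ (+-comm (- 1#) (- y)) ⟩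
    (1# + x) + (- y - 1#)   ≈⟨ sym (+-assoc _ _ _) ⟩
    ((1# + x) - y) - 1#     ≈⟨ +-congʳ (+-assoc 1# x (- y)) ⟩
    (1# + (x - y)) - 1#     ≈⟨ xyx⁻¹≈y 1# (x - y) ⟩
    x - y                   ∎

  ⊖-homo : ∀ m n → ⟦ m ⊖ n ⟧ℤ ≈ m ·× 1# - n ·× 1#
  ⊖-homo m zero = begin
    ⟦ m ⊖ zero ⟧ℤ   ≈⟨ reflexive (≡.cong ⟦_⟧ℤ (ℤP.⊖-≥ {m} {0} ℕ.z≤n)) ⟩
    m ·× 1#         ≈⟨ sym (+-identityʳ _) ⟩
    m ·× 1# + 0#    ≈⟨ +-congˡ (sym -0#≈0#) ⟩
    m ·× 1# - 0#    ∎
  ⊖-homo zero (suc n) = sym (+-identityˡ _)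
  ⊖-homo (suc m) (suc n) = begin
    ⟦ suc m ⊖ suc n ⟧ℤ                ≈⟨ reflexive (≡.cong ⟦_⟧ℤ (ℤP.[1+m]⊖[1+n]≡m⊖n m n)) ⟩
    ⟦ m ⊖ n ⟧ℤ                        ≈⟨ ⊖-homo m n ⟩
    m ·× 1# - n ·× 1#                 ≈⟨ sym (suc-minus-suc _ _) ⟩
    (1# + m ·× 1#) - (1# + n ·× 1#)   ≈⟨ +-cong (sym (1+× m 1#)) (-‿cong (sym (1+× n 1#))) ⟩
    suc m ·× 1# - suc n ·× 1#         ∎

  +-homo : ∀ i j → ⟦ i ℤ.+ j ⟧ℤ ≈ ⟦ i ⟧ℤ + ⟦ j ⟧ℤ
  +-homo (+ m) (+ n) = ×-homo-+ 1# m n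
  +-homo (+ m) -[1+ n ] = ⊖-homo m (suc n)
  +-homo -[1+ m ] (+ n) = trans (⊖-homo n (suc m)) (+-comm _ _)
  +-homo -[1+ m ] -[1+ n ] = begin
    - (suc (suc (m ℕ.+ n)) ·× 1#)    ≈⟨ -‿cong (reflexive (≡.cong (λ k → suc k ·× 1#) (≡.sym (ℕP.+-suc m n)))) ⟩
    - ((suc m ℕ.+ suc n) ·× 1#)      ≈⟨ -‿cong (×-homo-+ 1# (suc m) (suc n)) ⟩
    - (suc m ·× 1# + suc n ·× 1#)    ≈⟨ sym (⁻¹-∙-comm _ _) ⟩
    - (suc m ·× 1#) - (suc n ·× 1#)  ∎

  neg-homo : ∀ i → ⟦ ℤ.- i ⟧ℤ ≈ - ⟦ i ⟧ℤ
  neg-homo (+ zero) = sym -0#≈0#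
  neg-homo (+ suc n) = refl
  neg-homo -[1+ n ] = sym (-‿involutive _)

  -- multiplicativity is checked through the decomposition i = sign i · ∣ i ∣
  ⟦_⟧sign : Sign → Carrier
  ⟦ Sign.+ ⟧sign = 1#
  ⟦ Sign.- ⟧sign = - 1#

  ◃-homo : ∀ s n → ⟦ s ℤ.◃ n ⟧ℤ ≈ ⟦ s ⟧sign * (n ·× 1#)
  ◃-homo s zero = sym (zeroʳ _)
  ◃-homo Sign.+ (suc n) = sym (*-identityˡ _)
  ◃-homo Sign.- (suc n) = sym (-1*x≈-x _)

  sign-abs-homo : ∀ i → ⟦ i ⟧ℤ ≈ ⟦ ℤ.sign i ⟧sign * (ℤ.∣ i ∣ ·× 1#)
  sign-abs-homo (+ n) = sym (*-identityˡ _)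
  sign-abs-homo -[1+ n ] = sym (-1*x≈-x _)

  sign-*-homo : ∀ s t → ⟦ s Sign.* t ⟧sign ≈ ⟦ s ⟧sign * ⟦ t ⟧sign
  sign-*-homo Sign.+ t = sym (*-identityˡ _)
  sign-*-homo Sign.- Sign.+ = sym (*-identityʳ _)
  sign-*-homo Sign.- Sign.- = sym (trans (-1*x≈-x _) (-‿involutive _))

  *-interchange : ∀ a b x y → (a * b) * (x * y) ≈ (a * x) * (b * y)
  *-interchange a b x y = begin
    (a * b) * (x * y)   ≈⟨ *-assoc a b _ ⟩
    a * (b * (x * y))   ≈⟨ *-congˡ (sym (*-assoc b x y)) ⟩
    a * ((b * x) * y)   ≈⟨ *-congˡ (*-congʳ (*-comm b x)) ⟩
    a * ((x * b) * y)   ≈⟨ *-congˡ (*-assoc x b y) ⟩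
    a * (x * (b * y))   ≈⟨ sym (*-assoc a x _) ⟩
    (a * x) * (b * y)   ∎

  *-homo : ∀ i j → ⟦ i ℤ.* j ⟧ℤ ≈ ⟦ i ⟧ℤ * ⟦ j ⟧ℤ
  *-homo i j = begin
    ⟦ i ℤ.* j ⟧ℤ
      ≈⟨ ◃-homo (ℤ.sign i Sign.* ℤ.sign j) (ℤ.∣ i ∣ ℕ.* ℤ.∣ j ∣) ⟩
    ⟦ ℤ.sign i Sign.* ℤ.sign j ⟧sign * ((ℤ.∣ i ∣ ℕ.* ℤ.∣ j ∣) ·× 1#)
      ≈⟨ *-cong (sign-*-homo (ℤ.sign i) (ℤ.sign j)) (×1-homo-* ℤ.∣ i ∣ ℤ.∣ j ∣) ⟩
    (⟦ ℤ.sign i ⟧sign * ⟦ ℤ.sign j ⟧sign) * ((ℤ.∣ i ∣ ·× 1#) * (ℤ.∣ j ∣ ·× 1#))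
      ≈⟨ *-interchange _ _ _ _ ⟩
    (⟦ ℤ.sign i ⟧sign * (ℤ.∣ i ∣ ·× 1#)) * (⟦ ℤ.sign j ⟧sign * (ℤ.∣ j ∣ ·× 1#))
      ≈⟨ sym (*-cong (sign-abs-homo i) (sign-abs-homo j)) ⟩
    ⟦ i ⟧ℤ * ⟦ j ⟧ℤ ∎

  ℤ⟶R : ℤ.+-*-rawRing -Raw-AlmostCommutative⟶ fromCommutativeRing R
  ℤ⟶R = record
    { ⟦_⟧ = ⟦_⟧ℤ ; +-homo = +-homo ; *-homo = *-homo ; -‿homo = neg-homo
    ; 0-homo = refl ; 1-homo = refl }

  ℤ-coefficients-equal? : ∀ i j → Maybe (⟦ i ⟧ℤ ≈ ⟦ j ⟧ℤ)
  ℤ-coefficients-equal? i j with i ℤ.≟ j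
  ... | yes ≡.refl = just refl
  ... | no _ = nothing

  open import Algebra.Solver.Ring ℤ.+-*-rawRing (fromCommutativeRing R) ℤ⟶R ℤ-coefficients-equal? public

module ValueOrder where
  open import Data.Nat as ℕ using (suc)
  import Data.Nat.Properties as ℕP
  open import Data.Integer as ℤ using (+_; -[1+_]; 1ℤ; +<+; +≤+)
  import Data.Integer.Properties as ℤP
  open import Data.Product using (_,_)
  open import Data.Sum using (inj₁; inj₂)
  open import Data.Unit using (tt)
  open import Data.Empty using (⊥-elim)
  open import Relation.Nullary using (Dec; yes; no)
  open import Relation.Nullary.Decidable using (_×-dec_; _⊎-dec_)
  open import Relation.Binary.PropositionalEquality using (_≡_; refl; sym; cong₂)

  ≤v-refl : ∀ x → x ≤v x
  ≤v-refl (fin a b) = inj₂ (refl , ℤP.≤-refl)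
  ≤v-refl ∞ = tt

  ≤v-reflexive : ∀ {x y} → x ≡ y → x ≤v y
  ≤v-reflexive {x} refl = ≤v-refl x

  ≤v-trans : ∀ {x y z} → x ≤v y → y ≤v z → x ≤v z
  ≤v-trans {z = ∞} p q = tt
  ≤v-trans {fin a b} {fin c d} {fin e f} (inj₁ p) (inj₁ q) = inj₁ (ℤP.<-trans p q)
  ≤v-trans {fin a b} {fin c d} {fin e f} (inj₁ p) (inj₂ (refl , _)) = inj₁ p
  ≤v-trans {fin a b} {fin c d} {fin e f} (inj₂ (refl , _)) (inj₁ q) = inj₁ q
  ≤v-trans {fin a b} {fin c d} {fin e f} (inj₂ (refl , p)) (inj₂ (refl , q)) = inj₂ (refl , ℤP.≤-trans p q)

  _≤v?_ : ∀ w x → Dec (w ≤v x)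
  w ≤v? ∞ = yes tt
  ∞ ≤v? fin _ _ = no (λ ())
  fin a b ≤v? fin c d = (b ℤP.<? d) ⊎-dec ((b ℤP.≟ d) ×-dec (a ℤP.≤? c))

  fin-injective : ∀ {a b c d} → fin a b ≡ fin c d → (a ≡ c) × (b ≡ d)
  fin-injective refl = refl , refl

  vAdd-mono : ∀ {w₁ w₂ x y} → w₁ ≤v x → w₂ ≤v y → vAdd w₁ w₂ ≤v vAdd x y
  vAdd-mono {x = ∞} p q = tt
  vAdd-mono {x = fin _ _} {y = ∞} p q = tt
  vAdd-mono {fin _ _} {fin _ _} {fin _ _} {fin _ _} (inj₁ p) (inj₁ q) = inj₁ (ℤP.+-mono-< p q)
  vAdd-mono {fin _ _} {fin _ d} {fin _ _} {fin _ _} (inj₁ p) (inj₂ (refl , _)) = inj₁ (ℤP.+-mono-<-≤ p (ℤP.≤-refl {d}))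
  vAdd-mono {fin _ b} {fin _ _} {fin _ _} {fin _ _} (inj₂ (refl , _)) (inj₁ q) = inj₁ (ℤP.+-mono-≤-< (ℤP.≤-refl {b}) q)
  vAdd-mono {fin _ _} {fin _ _} {fin _ _} {fin _ _} (inj₂ (refl , p)) (inj₂ (refl , q)) = inj₂ (refl , ℤP.+-mono-≤ p q)

  vAdd-identityˡ : ∀ x → vAdd (fin 0ℤ 0ℤ) x ≡ x
  vAdd-identityˡ (fin a b) = cong₂ fin (ℤP.+-identityˡ a) (ℤP.+-identityˡ b)
  vAdd-identityˡ ∞ = refl

  vAdd-identityʳ : ∀ x → vAdd x (fin 0ℤ 0ℤ) ≡ x
  vAdd-identityʳ (fin a b) = cong₂ fin (ℤP.+-identityʳ a) (ℤP.+-identityʳ b)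
  vAdd-identityʳ ∞ = refl

  vAdd-idempotent : ∀ {a b} → fin a b ≡ vAdd (fin a b) (fin a b) → fin a b ≡ fin 0ℤ 0ℤ
  vAdd-idempotent {a} {b} e = cong₂ fin (idempotent a a≡a+a) (idempotent b b≡b+b)
    where
    a≡a+a = proj₁ (fin-injective e)
    b≡b+b = proj₂ (fin-injective e)
    open import Algebra.Properties.Ring ℤP.+-*-ring using (x+x≈x⇒x≈0)
    idempotent : ∀ i → i ≡ i ℤ.+ i → i ≡ 0ℤ
    idempotent i i≡i+i = x+x≈x⇒x≈0 i (sym i≡i+i)

  vAdd-halve-zero : ∀ x → vAdd x x ≡ fin 0ℤ 0ℤ → x ≡ fin 0ℤ 0ℤ
  vAdd-halve-zero (fin a b) e = cong₂ fin (halve a (proj₁ (fin-injective e))) (halve b (proj₂ (fin-injective e)))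
    where
    halve : ∀ i → i ℤ.+ i ≡ 0ℤ → i ≡ 0ℤ
    halve (+ 0) _ = refl
    halve (+ suc n) ()
    halve -[1+ n ] ()
  vAdd-halve-zero ∞ ()

  Positive : ValInf → Set
  Positive w = fin 0ℤ 0ℤ <v w

  0≤1 : fin 0ℤ 0ℤ ≤v fin 1ℤ 0ℤ
  0≤1 = inj₂ (refl , +≤+ ℕ.z≤n)

  1≰0 : ¬ (fin 1ℤ 0ℤ ≤v fin 0ℤ 0ℤ)
  1≰0 (inj₁ (+<+ ()))
  1≰0 (inj₂ (_ , +≤+ ()))

  positive⇒1≤ : ∀ {w} → Positive w → fin 1ℤ 0ℤ ≤v w
  positive⇒1≤ {fin i j} (inj₁ p) = inj₁ p
  positive⇒1≤ {fin i j} (inj₂ (e , p)) = inj₂ (e , ℤP.i<j⇒suc[i]≤j p)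
  positive⇒1≤ {∞} _ = tt

  positive⇒0≤ : ∀ {w} → Positive w → fin 0ℤ 0ℤ ≤v w
  positive⇒0≤ p = ≤v-trans 0≤1 (positive⇒1≤ p)

  -- a positive value is at most its double; this makes P_w closed under products
  positive⇒≤double : ∀ {w} → Positive w → w ≤v vAdd w w
  positive⇒≤double {fin i (+ n)} (inj₁ (+<+ 0<n)) = inj₁ (+<+ (ℕP.m<m+n n 0<n))
  positive⇒≤double {fin (+ m) (+ 0)} (inj₂ (refl , +<+ _)) = inj₂ (refl , +≤+ (ℕP.m≤m+n m m))
  positive⇒≤double {∞} _ = tt

  between-0-and-1 : ∀ x → fin 0ℤ 0ℤ ≤v x → ¬ (fin 1ℤ 0ℤ ≤v x) → x ≡ fin 0ℤ 0ℤ
  between-0-and-1 ∞ _ x≱1 = ⊥-elim (x≱1 tt)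
  between-0-and-1 (fin a b) (inj₁ p) x≱1 = ⊥-elim (x≱1 (inj₁ p))
  between-0-and-1 (fin (+ 0) b) (inj₂ (refl , _)) x≱1 = refl
  between-0-and-1 (fin (+ suc n) b) (inj₂ (refl , _)) x≱1 = ⊥-elim (x≱1 (inj₂ (refl , +≤+ (ℕ.s≤s ℕ.z≤n))))
  between-0-and-1 (fin -[1+ n ] b) (inj₂ (refl , ()))

module CongruenceSubgroups {c ℓ : Level} (F : TwoDimLocalField c ℓ) where
  open TwoDimLocalField F
  open IntegerCoefficientSolver commRing using (Polynomial; solve; con; _:+_; _:*_; _:-_; :-_; _:=_)
  open ValueOrder
  open import Algebra.Properties.Ring (CommutativeRing.ring commRing) using (-1*x≈-x; -‿involutive)
  open import Data.Integer using (+_; 1ℤ)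
  open import Data.Product using (_,_)
  open import Data.Sum using (inj₁; inj₂)
  open import Data.Empty using (⊥-elim)
  open import Relation.Nullary using (Dec; yes; no)
  open import Relation.Nullary.Decidable using (_×-dec_)
  open import Relation.Binary.Bundles using (Setoid)
  open import Function.Bundles using (mk⇔; Equivalence)
  import Relation.Binary.PropositionalEquality as ≡
  import Relation.Binary.Reasoning.Setoid as SetoidReasoning

  :1 :0 : ∀ {k} → Polynomial k
  :1 = con (+ 1)
  :0 = con (+ 0)

  v-1# : v 1# ≡.≡ fin 0ℤ 0ℤ
  v-1# with v 1# in v1≡
  ... | ∞ = ⊥-elim (1≉0 (Equivalence.to (v-∞ 1#) v1≡))
  ... | fin a b = vAdd-idempotent (begin
    fin a b                       ≡⟨ ≡.sym v1≡ ⟩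
    v 1#                          ≡⟨ v-cong (sym (*-identityʳ 1#)) ⟩
    v (1# * 1#)                   ≡⟨ v-mul 1# 1# ⟩
    vAdd (v 1#) (v 1#)            ≡⟨ ≡.cong₂ vAdd v1≡ v1≡ ⟩
    vAdd (fin a b) (fin a b)      ∎)
    where open ≡.≡-Reasoning

  v-minus-1# : v (- 1#) ≡.≡ fin 0ℤ 0ℤ
  v-minus-1# = vAdd-halve-zero (v (- 1#)) (begin
    vAdd (v (- 1#)) (v (- 1#))    ≡⟨ ≡.sym (v-mul (- 1#) (- 1#)) ⟩
    v (- 1# * - 1#)               ≡⟨ v-cong (trans (-1*x≈-x (- 1#)) (-‿involutive 1#)) ⟩
    v 1#                          ≡⟨ v-1# ⟩
    fin 0ℤ 0ℤ                     ∎)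
    where open ≡.≡-Reasoning

  -- w ≼ x : x lies in the fractional ideal P_w = {x : w ≤ v x}; thus
  -- fin 0ℤ 0ℤ ≼ x says x ∈ O_F.  The closure properties of these ideals follow.
  infix 4 _≼_
  _≼_ : ValInf → Carrier → Set
  w ≼ x = w ≤v v x

  ≼-cong : ∀ {w x y} → x ≈ y → w ≼ x → w ≼ y
  ≼-cong {w} x≈y = ≡.subst (w ≤v_) (v-cong x≈y)

  ≼-+ : ∀ {w x y} → w ≼ x → w ≼ y → w ≼ x + y
  ≼-+ {w} {x} {y} = v-add x y w

  ≼-* : ∀ {w₁ w₂ x y} → w₁ ≼ x → w₂ ≼ y → vAdd w₁ w₂ ≼ x * y
  ≼-* {w₁} {w₂} {x} {y} p q = ≡.subst (vAdd w₁ w₂ ≤v_) (≡.sym (v-mul x y)) (vAdd-mono p q)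

  ≼-*O : ∀ {w x y} → w ≼ x → fin 0ℤ 0ℤ ≼ y → w ≼ x * y
  ≼-*O {w} {x} {y} p q = ≡.subst (_≤v v (x * y)) (vAdd-identityʳ w) (≼-* p q)

  O*-≼ : ∀ {w x y} → fin 0ℤ 0ℤ ≼ x → w ≼ y → w ≼ x * y
  O*-≼ {w} {x} {y} p q = ≡.subst (_≤v v (x * y)) (vAdd-identityˡ w) (≼-* p q)

  ≼-*-positive : ∀ {w x y} → Positive w → w ≼ x → w ≼ y → w ≼ x * y
  ≼-*-positive pw p q = ≤v-trans (positive⇒≤double pw) (≼-* p q)

  ≼-neg : ∀ {w x} → w ≼ x → w ≼ - x
  ≼-neg {x = x} p = ≼-cong (-1*x≈-x x) (O*-≼ (≤v-reflexive (≡.sym v-minus-1#)) p)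

  ≼-- : ∀ {w x y} → w ≼ x → w ≼ y → w ≼ x - y
  ≼-- p q = ≼-+ p (≼-neg q)

  1∈O : fin 0ℤ 0ℤ ≼ 1#
  1∈O = ≤v-reflexive (≡.sym v-1#)

  1∉P₁ : ¬ (fin 1ℤ 0ℤ ≼ 1#)
  1∉P₁ p = 1≰0 (≡.subst (fin 1ℤ 0ℤ ≤v_) v-1# p)

  near-one⇒unit : ∀ {w u} → Positive w → w ≼ u - 1# → v u ≡.≡ fin 0ℤ 0ℤ
  near-one⇒unit {u = u} pw u≡1 = between-0-and-1 (v u) u∈O u∉P₁
    where
    u-1∈P₁ : fin 1ℤ 0ℤ ≼ u - 1#
    u-1∈P₁ = ≤v-trans (positive⇒1≤ pw) u≡1
    u∈O : fin 0ℤ 0ℤ ≼ u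
    u∈O = ≼-cong (solve 1 (λ u → (u :- :1) :+ :1 := u) refl u)
                 (≼-+ (≤v-trans (positive⇒0≤ pw) u≡1) 1∈O)
    u∉P₁ : ¬ (fin 1ℤ 0ℤ ≼ u)
    u∉P₁ u∈P₁ = 1∉P₁ (≼-cong (solve 1 (λ u → u :- (u :- :1) := :1) refl u) (≼-- u∈P₁ u-1∈P₁))

  nonzero-value : ∀ {x a b} → v x ≡.≡ fin a b → ¬ (x ≈ 0#)
  nonzero-value {x} vx≡fin x≈0 with ≡.trans (≡.sym vx≡fin) (Equivalence.from (v-∞ x) x≈0)
  ... | ()

  inverse-near-one : ∀ {w u e} → Positive w → w ≼ u - 1# → u * e ≈ 1# →
                     (fin 0ℤ 0ℤ ≼ e) × (w ≼ e - 1#)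
  inverse-near-one {w} {u} {e} pw u≡1 ue≈1 = e∈O , e≡1
    where
    ve≡0 : v e ≡.≡ fin 0ℤ 0ℤ
    ve≡0 = begin
      v e                         ≡⟨ ≡.sym (vAdd-identityˡ (v e)) ⟩
      vAdd (fin 0ℤ 0ℤ) (v e)      ≡⟨ ≡.cong (λ x → vAdd x (v e)) (≡.sym (near-one⇒unit pw u≡1)) ⟩
      vAdd (v u) (v e)            ≡⟨ ≡.sym (v-mul u e) ⟩
      v (u * e)                   ≡⟨ v-cong ue≈1 ⟩
      v 1#                        ≡⟨ v-1# ⟩
      fin 0ℤ 0ℤ                   ∎
      where open ≡.≡-Reasoning
    e∈O : fin 0ℤ 0ℤ ≼ e
    e∈O = ≤v-reflexive (≡.sym ve≡0)
    -- e - 1 = e - u e = -((u - 1) e)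
    e-1≈ : - ((u - 1#) * e) ≈ e - 1#
    e-1≈ = trans (solve 2 (λ u e → :- ((u :- :1) :* e) := e :- u :* e) refl u e)
                 (+-congˡ (-‿cong ue≈1))
    e≡1 : w ≼ e - 1#
    e≡1 = ≼-cong e-1≈ (≼-neg (≼-*O u≡1 e∈O))

  I : M2
  I = mat 1# 0# 0# 1#

  M2-setoid : Setoid c ℓ
  M2-setoid = record
    { Carrier = M2
    ; _≈_ = _≈M_
    ; isEquivalence = record { refl = ≈M-refl ; sym = ≈M-sym ; trans = ≈M-trans }
    }
    where
    ≈M-refl : ∀ {x} → x ≈M x
    ≈M-refl {mat _ _ _ _} = refl , refl , refl , refl
    ≈M-sym : ∀ {x y} → x ≈M y → y ≈M x
    ≈M-sym {mat _ _ _ _} {mat _ _ _ _} (p , q , r , s) = sym p , sym q , sym r , sym s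
    ≈M-trans : ∀ {x y z} → x ≈M y → y ≈M z → x ≈M z
    ≈M-trans {mat _ _ _ _} {mat _ _ _ _} {mat _ _ _ _} (p , q , r , s) (p' , q' , r' , s') =
      trans p p' , trans q q' , trans r r' , trans s s'

  module ≈M-Reasoning = SetoidReasoning M2-setoid
  open Setoid M2-setoid using () renaming (refl to ≈M-refl; sym to ≈M-sym; trans to ≈M-trans)

  ·-cong : ∀ {x x' y y'} → x ≈M x' → y ≈M y' → x · y ≈M x' · y'
  ·-cong {mat _ _ _ _} {mat _ _ _ _} {mat _ _ _ _} {mat _ _ _ _} (p , q , r , s) (p' , q' , r' , s') =
    +-cong (*-cong p p') (*-cong q r') , +-cong (*-cong p q') (*-cong q s') ,
    +-cong (*-cong r p') (*-cong s r') , +-cong (*-cong r q') (*-cong s s')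

  ·-assoc : ∀ x y z → (x · y) · z ≈M x · (y · z)
  ·-assoc (mat a b c' d) (mat e f g h) (mat p q r s) =
    entry a b e f g h p r , entry a b e f g h q s , entry c' d e f g h p r , entry c' d e f g h q s
    where
    entry : ∀ a b e f g h p r → (a * e + b * g) * p + (a * f + b * h) * r ≈ a * (e * p + f * r) + b * (g * p + h * r)
    entry = solve 8 (λ a b e f g h p r →
      (a :* e :+ b :* g) :* p :+ (a :* f :+ b :* h) :* r := a :* (e :* p :+ f :* r) :+ b :* (g :* p :+ h :* r)) refl

  ·-identityˡ : ∀ x → I · x ≈M x
  ·-identityˡ (mat e f g h) = first e g , first f h , second e g , second f h
    where
    first : ∀ x y → 1# * x + 0# * y ≈ x
    first = solve 2 (λ x y → :1 :* x :+ :0 :* y := x) refl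
    second : ∀ x y → 0# * x + 1# * y ≈ y
    second = solve 2 (λ x y → :0 :* x :+ :1 :* y := y) refl

  ·-identityʳ : ∀ x → x · I ≈M x
  ·-identityʳ (mat a b c' d) = first a b , second a b , first c' d , second c' d
    where
    first : ∀ x y → x * 1# + y * 0# ≈ x
    first = solve 2 (λ x y → x :* :1 :+ y :* :0 := x) refl
    second : ∀ x y → x * 0# + y * 1# ≈ y
    second = solve 2 (λ x y → x :* :0 :+ y :* :1 := y) refl

  scaledAdjugate : M2 → Carrier → M2
  scaledAdjugate (mat a b c' d) e = mat (d * e) ((- b) * e) ((- c') * e) (a * e)

  scaledAdjugate-inverseʳ : ∀ g e → det g * e ≈ 1# → g · scaledAdjugate g e ≈M I
  scaledAdjugate-inverseʳ (mat a b c' d) e δe≈1 =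
    trans (diagonal₁ a b c' d e) δe≈1 , offDiagonal₁ a b e ,
    offDiagonal₂ c' d e , trans (diagonal₂ a b c' d e) δe≈1
    where
    diagonal₁ : ∀ a b c' d e → a * (d * e) + b * ((- c') * e) ≈ (a * d - b * c') * e
    diagonal₁ = solve 5 (λ a b c' d e → a :* (d :* e) :+ b :* ((:- c') :* e) := (a :* d :- b :* c') :* e) refl
    offDiagonal₁ : ∀ a b e → a * ((- b) * e) + b * (a * e) ≈ 0#
    offDiagonal₁ = solve 3 (λ a b e → a :* ((:- b) :* e) :+ b :* (a :* e) := :0) refl
    offDiagonal₂ : ∀ c' d e → c' * (d * e) + d * ((- c') * e) ≈ 0#
    offDiagonal₂ = solve 3 (λ c' d e → c' :* (d :* e) :+ d :* ((:- c') :* e) := :0) refl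
    diagonal₂ : ∀ a b c' d e → c' * ((- b) * e) + d * (a * e) ≈ (a * d - b * c') * e
    diagonal₂ = solve 5 (λ a b c' d e → c' :* ((:- b) :* e) :+ d :* (a :* e) := (a :* d :- b :* c') :* e) refl

  scaledAdjugate-inverseˡ : ∀ g e → det g * e ≈ 1# → scaledAdjugate g e · g ≈M I
  scaledAdjugate-inverseˡ (mat a b c' d) e δe≈1 =
    trans (diagonal₁ a b c' d e) δe≈1 , offDiagonal₁ b d e ,
    offDiagonal₂ a c' e , trans (diagonal₂ a b c' d e) δe≈1
    where
    diagonal₁ : ∀ a b c' d e → (d * e) * a + ((- b) * e) * c' ≈ (a * d - b * c') * e
    diagonal₁ = solve 5 (λ a b c' d e → (d :* e) :* a :+ ((:- b) :* e) :* c' := (a :* d :- b :* c') :* e) refl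
    offDiagonal₁ : ∀ b d e → (d * e) * b + ((- b) * e) * d ≈ 0#
    offDiagonal₁ = solve 3 (λ b d e → (d :* e) :* b :+ ((:- b) :* e) :* d := :0) refl
    offDiagonal₂ : ∀ a c' e → ((- c') * e) * a + (a * e) * c' ≈ 0#
    offDiagonal₂ = solve 3 (λ a c' e → ((:- c') :* e) :* a :+ (a :* e) :* c' := :0) refl
    diagonal₂ : ∀ a b c' d e → ((- c') * e) * b + (a * e) * d ≈ (a * d - b * c') * e
    diagonal₂ = solve 5 (λ a b c' d e → ((:- c') :* e) :* b :+ (a :* e) :* d := (a :* d :- b :* c') :* e) refl

  GL₂-inverse : ∀ {g} → GL₂ g → Σ M2 λ g⁻¹ → (g · g⁻¹ ≈M I) × (g⁻¹ · g ≈M I)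
  GL₂-inverse {g} g∈GL₂ with inverse (det g) g∈GL₂
  ... | e , δe≈1 = scaledAdjugate g e , scaledAdjugate-inverseʳ g e δe≈1 , scaledAdjugate-inverseˡ g e δe≈1

  K-cong : ∀ {i j k k'} → k ≈M k' → K i j k → K i j k'
  K-cong {k = mat _ _ _ _} {mat _ _ _ _} (p , q , r , s) (ha , hb , hc , hd) =
    ≼-cong (+-congʳ p) ha , ≼-cong q hb , ≼-cong r hc , ≼-cong (+-congʳ s) hd

  K-antitone : ∀ {i j m n k} → fin i j ≤v fin m n → K m n k → K i j k
  K-antitone {k = mat _ _ _ _} le (ha , hb , hc , hd) =
    ≤v-trans le ha , ≤v-trans le hb , ≤v-trans le hc , ≤v-trans le hd

  K? : ∀ i j k → Dec (K i j k)
  K? i j (mat a b c' d) = (_ ≤v? _) ×-dec ((_ ≤v? _) ×-dec ((_ ≤v? _) ×-dec (_ ≤v? _)))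

  -- For positive (i,j), K_{i,j} is closed under products: writing k = I + X,
  -- k' = I + X', the product is I + X + X' + X X', and P_{(i,j)} is an ideal
  -- closed under products.
  K-· : ∀ {i j k k'} → Positive (fin i j) → K i j k → K i j k' → K i j (k · k')
  K-· {i} {j} {mat a b c' d} {mat e f g h} pw (ha , hb , hc , hd) (he , hf , hg , hh) =
    ≼-cong (sym (entry₁₁ a b e g)) (≼-+ (≼-+ (≼-+ ha he) (P* ha he)) (P* hb hg)) ,
    ≼-cong (sym (entry₁₂ a b f h)) (≼-+ (≼-+ (≼-+ (P* ha hf) hf) (P* hb hh)) hb) ,
    ≼-cong (sym (entry₂₁ c' d e g)) (≼-+ (≼-+ (≼-+ (P* hc he) hc) (P* hd hg)) hg) ,
    ≼-cong (sym (entry₂₂ c' d f h)) (≼-+ (≼-+ (≼-+ (P* hc hf) hd) hh) (P* hd hh))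
    where
    P* : ∀ {x y} → fin i j ≼ x → fin i j ≼ y → fin i j ≼ x * y
    P* = ≼-*-positive pw
    entry₁₁ : ∀ a b e g → (a * e + b * g) - 1# ≈ (((a - 1#) + (e - 1#)) + (a - 1#) * (e - 1#)) + b * g
    entry₁₁ = solve 4 (λ a b e g →
      (a :* e :+ b :* g) :- :1 := (((a :- :1) :+ (e :- :1)) :+ (a :- :1) :* (e :- :1)) :+ b :* g) refl
    entry₁₂ : ∀ a b f h → a * f + b * h ≈ (((a - 1#) * f + f) + b * (h - 1#)) + b
    entry₁₂ = solve 4 (λ a b f h → a :* f :+ b :* h := (((a :- :1) :* f :+ f) :+ b :* (h :- :1)) :+ b) refl
    entry₂₁ : ∀ c' d e g → c' * e + d * g ≈ ((c' * (e - 1#) + c') + (d - 1#) * g) + g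
    entry₂₁ = solve 4 (λ c' d e g → c' :* e :+ d :* g := ((c' :* (e :- :1) :+ c') :+ (d :- :1) :* g) :+ g) refl
    entry₂₂ : ∀ c' d f h → (c' * f + d * h) - 1# ≈ ((c' * f + (d - 1#)) + (h - 1#)) + (d - 1#) * (h - 1#)
    entry₂₂ = solve 4 (λ c' d f h →
      (c' :* f :+ d :* h) :- :1 := ((c' :* f :+ (d :- :1)) :+ (h :- :1)) :+ (d :- :1) :* (h :- :1)) refl

  K-det : ∀ {i j k} → Positive (fin i j) → K i j k → fin i j ≼ det k - 1#
  K-det {i} {j} {mat a b c' d} pw (ha , hb , hc , hd) =
    ≼-cong (sym (expand a b c' d)) (≼-- (≼-+ (≼-+ ha hd) (≼-*-positive pw ha hd)) (≼-*-positive pw hb hc))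
    where
    expand : ∀ a b c' d → (a * d - b * c') - 1# ≈ (((a - 1#) + (d - 1#)) + (a - 1#) * (d - 1#)) - b * c'
    expand = solve 4 (λ a b c' d →
      (a :* d :- b :* c') :- :1 := (((a :- :1) :+ (d :- :1)) :+ (a :- :1) :* (d :- :1)) :- b :* c') refl

  -- For positive (i,j), K_{i,j} is closed under inverses: det k is a unit of
  -- O_F congruent to 1, so its inverse e is too, and the entries of the
  -- inverse (det k)⁻¹ adj(k) are congruent to those of I.
  K-inverse : ∀ {i j k} → Positive (fin i j) → K i j k → Σ M2 λ k⁻¹ → K i j k⁻¹ × (k · k⁻¹ ≈M I)
  K-inverse {i} {j} {mat a b c' d} pw k∈K@(ha , hb , hc , hd) =
    scaledAdjugate k e , k⁻¹∈K , scaledAdjugate-inverseʳ k e δe≈1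
    where
    k : M2
    k = mat a b c' d
    δ≡1 : fin i j ≼ det k - 1#
    δ≡1 = K-det pw k∈K
    e : Carrier
    e = proj₁ (inverse (det k) (nonzero-value (near-one⇒unit pw δ≡1)))
    δe≈1 : det k * e ≈ 1#
    δe≈1 = proj₂ (inverse (det k) (nonzero-value (near-one⇒unit pw δ≡1)))
    e∈O : fin 0ℤ 0ℤ ≼ e
    e∈O = proj₁ (inverse-near-one pw δ≡1 δe≈1)
    e≡1 : fin i j ≼ e - 1#
    e≡1 = proj₂ (inverse-near-one pw δ≡1 δe≈1)
    diagonal : ∀ x → fin i j ≼ x - 1# → fin i j ≼ x * e - 1#
    diagonal x x≡1 = ≼-cong (solve 2 (λ x e → (x :- :1) :* e :+ (e :- :1) := x :* e :- :1) refl x e)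
                            (≼-+ (≼-*O x≡1 e∈O) e≡1)
    k⁻¹∈K : K i j (scaledAdjugate k e)
    k⁻¹∈K = diagonal d hd , ≼-*O (≼-neg hb) e∈O , ≼-*O (≼-neg hc) e∈O , diagonal a ha

  coset-absorbs : ∀ {i j m n g g⁻¹ h} → Positive (fin i j) → fin i j ≤v fin m n →
                  g · g⁻¹ ≈M I → K i j (g⁻¹ · h) →
                  ∀ x → InCoset h m n x → InCoset g i j x
  coset-absorbs {g = g} {g⁻¹} {h} pw ij≤mn gg⁻¹≈I g⁻¹h∈K x (k' , k'∈K , x≈hk') =
    (g⁻¹ · h) · k' , K-· pw g⁻¹h∈K (K-antitone ij≤mn k'∈K) , x≈g[g⁻¹h]k'
    where
    open ≈M-Reasoning
    x≈g[g⁻¹h]k' : x ≈M g · ((g⁻¹ · h) · k')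
    x≈g[g⁻¹h]k' = begin
      x                       ≈⟨ x≈hk' ⟩
      h · k'                  ≈⟨ ·-cong (≈M-sym (·-identityˡ h)) ≈M-refl ⟩
      (I · h) · k'            ≈⟨ ·-cong (·-cong (≈M-sym gg⁻¹≈I) ≈M-refl) ≈M-refl ⟩
      ((g · g⁻¹) · h) · k'    ≈⟨ ·-cong (·-assoc g g⁻¹ h) ≈M-refl ⟩
      (g · (g⁻¹ · h)) · k'    ≈⟨ ·-assoc g (g⁻¹ · h) k' ⟩
      g · ((g⁻¹ · h) · k')    ∎

  -- If g K_{i,j} and h K_{m,n} meet, say g k = h k', then g⁻¹ h = k k'⁻¹ ∈ K_{i,j}.
  cosets-meet : ∀ {i j m n g g⁻¹ h x} → Positive (fin i j) → fin i j ≤v fin m n →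
                g⁻¹ · g ≈M I → InCoset g i j x → InCoset h m n x → K i j (g⁻¹ · h)
  cosets-meet {i} {j} {g = g} {g⁻¹} {h} {x} pw ij≤mn g⁻¹g≈I (k , k∈K , x≈gk) (k' , k'∈K , x≈hk') =
    K-cong kk'⁻¹≈g⁻¹h (K-· pw k∈K k'⁻¹∈K)
    where
    open ≈M-Reasoning
    k'-invertible : Σ M2 λ k'⁻¹ → K i j k'⁻¹ × (k' · k'⁻¹ ≈M I)
    k'-invertible = K-inverse pw (K-antitone ij≤mn k'∈K)
    k'⁻¹ : M2
    k'⁻¹ = proj₁ k'-invertible
    k'⁻¹∈K : K i j k'⁻¹
    k'⁻¹∈K = proj₁ (proj₂ k'-invertible)
    k'k'⁻¹≈I : k' · k'⁻¹ ≈M I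
    k'k'⁻¹≈I = proj₂ (proj₂ k'-invertible)
    kk'⁻¹≈g⁻¹h : k · k'⁻¹ ≈M g⁻¹ · h
    kk'⁻¹≈g⁻¹h = begin
      k · k'⁻¹                    ≈⟨ ·-cong (≈M-sym (·-identityˡ k)) ≈M-refl ⟩
      (I · k) · k'⁻¹              ≈⟨ ·-cong (·-cong (≈M-sym g⁻¹g≈I) ≈M-refl) ≈M-refl ⟩
      ((g⁻¹ · g) · k) · k'⁻¹      ≈⟨ ·-cong (·-assoc g⁻¹ g k) ≈M-refl ⟩
      (g⁻¹ · (g · k)) · k'⁻¹      ≈⟨ ·-cong (·-cong ≈M-refl (≈M-trans (≈M-sym x≈gk) x≈hk')) ≈M-refl ⟩
      (g⁻¹ · (h · k')) · k'⁻¹     ≈⟨ ·-assoc g⁻¹ (h · k') k'⁻¹ ⟩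
      g⁻¹ · ((h · k') · k'⁻¹)     ≈⟨ ·-cong ≈M-refl (·-assoc h k' k'⁻¹) ⟩
      g⁻¹ · (h · (k' · k'⁻¹))     ≈⟨ ·-cong ≈M-refl (·-cong ≈M-refl k'k'⁻¹≈I) ⟩
      g⁻¹ · (h · I)               ≈⟨ ·-cong ≈M-refl (·-identityʳ h) ⟩
      g⁻¹ · h                     ∎


  DisjointOrNested : M2 → ℤ → ℤ → M2 → ℤ → ℤ → Set (c ⊔ ℓ)
  DisjointOrNested g i j h m n =
    (∀ x → ¬ (InCoset g i j x × InCoset h m n x))
    ⊎ (∀ x → (InCoset g i j x × InCoset h m n x) ⇔ InCoset g i j x)
    ⊎ (∀ x → (InCoset g i j x × InCoset h m n x) ⇔ InCoset h m n x)

  disjoint-or-nested : ∀ {i j m n g g⁻¹ h} → Positive (fin i j) → fin i j ≤v fin m n →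
                       g · g⁻¹ ≈M I → g⁻¹ · g ≈M I → Dec (K i j (g⁻¹ · h)) →
                       DisjointOrNested g i j h m n
  disjoint-or-nested pw ij≤mn gg⁻¹≈I _ (yes g⁻¹h∈K) = inj₂ (inj₂ λ x →
    mk⇔ proj₂ (λ x∈hK → coset-absorbs pw ij≤mn gg⁻¹≈I g⁻¹h∈K x x∈hK , x∈hK))
  disjoint-or-nested pw ij≤mn _ g⁻¹g≈I (no g⁻¹h∉K) = inj₁ λ x (x∈gK , x∈hK) →
    g⁻¹h∉K (cosets-meet pw ij≤mn g⁻¹g≈I x∈gK x∈hK)


mainTheorem2 : ∀ {c ℓ : Level} (F : TwoDimLocalField c ℓ) →
    let open TwoDimLocalField F in
    (i j m n : ℤ) → fin 0ℤ 0ℤ <v fin i j → fin i j ≤v fin m n →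
    (g h : M2) → GL₂ g → GL₂ h →
    (∀ x → ¬ (InCoset g i j x × InCoset h m n x))
    ⊎ (∀ x → (InCoset g i j x × InCoset h m n x) ⇔ InCoset g i j x)
    ⊎ (∀ x → (InCoset g i j x × InCoset h m n x) ⇔ InCoset h m n x)
mainTheorem2 F i j m n pw ij≤mn g h g∈GL₂ _ =
  disjoint-or-nested pw ij≤mn gg⁻¹≈I g⁻¹g≈I (K? i j (g⁻¹ · h))
  where
  open TwoDimLocalField F
  open CongruenceSubgroups F
  g-invertible : Σ M2 λ g⁻¹ → (g · g⁻¹ ≈M I) × (g⁻¹ · g ≈M I)
  g-invertible = GL₂-inverse g∈GL₂
  g⁻¹ : M2
  g⁻¹ = proj₁ g-invertible
  gg⁻¹≈I : g · g⁻¹ ≈M I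
  gg⁻¹≈I = proj₁ (proj₂ g-invertible)
  g⁻¹g≈I : g⁻¹ · g ≈M I
  g⁻¹g≈I = proj₂ (proj₂ g-invertible)
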